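{- Let $\mathbf L$ be a derivation system for $\Lambda(\mathcal L)$, let $\mathsf{Thm}=\{\psi\in\Lambda(\mathcal L):\ \vdash_{\mathbf L}\psi\}$ and let $\bar S$ be the set of non-modal homomorphisms $s:\Lambda(\mathcal L)\to A$ with $s(\psi)=1$ for all $\psi\in\mathsf{Thm}$. If $\varphi\in\Lambda(\mathcal L)$ and $\varphi\notin\mathsf{Thm}$, then there exists $s\in\bar S$ with $s(\varphi)<1$.
   Context: $\mathbb A$ with domain $A$ is one of: (i) a finite Łukasiewicz chain Ł$_n$ with language $\mathcal L$: $\varphi::=p\mid\bar1\mid\bar0\mid\varphi\vee\varphi\mid\varphi\wedge\varphi\mid\varphi\odot\varphi\mid\varphi\to\varphi$; (ii) a finite FL$_{ew}$-algebra (commutative integral bounded residuated lattice) with Baaz Delta $\Delta(x)=1$ iff $x=1$ (else $0$), language adding $\Delta$ and constants $\bar c$ for all $c\in A$; (iii) a finite FL$_{ew}$-algebra with $\tau_c(x)=1$ iff $x=c$, $\upsilon_c(x)=1$ iff $x\ge c$ (else $0$), language adding unary $\tau_c,\upsilon_c$. $p$ ranges over a set $\mathsf P$ of atoms; $\varphi\leftrightarrow\psi:=(\varphi\to\psi)\odot(\psi\to\varphi)$. $\Gamma\models_{\mathbb A}\varphi$ iff every homomorphic truth assignment into $\mathbb A$ sending all of $\Gamma$ to $1$ sends $\varphi$ to $1$; it is assumed there is an axiomatization $\mathbf{Ax}(\mathbb A)$ sound and complete for $\models_{\mathbb A}$ (for any set of atoms). $T:\mathsf{Set}\to\mathsf{Set}$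 is a functor, $\Lambda$ a set of predicate liftings $\lambda:Hom(-,A^n)\Rightarrow Hom(T(-),A)$, and $\Lambda(\mathcal L)$ extends $\mathcal L$ with formulas $\heartsuit_\lambda(\varphi_0,\dots,\varphi_{n-1})$ for $n$-ary $\lambda\in\Lambda$. A non-modal homomorphism is a map $h:\Lambda(\mathcal L)\to A$ with $h(\bar c)=c$ for all constants, commuting with $\vee,\wedge,\odot,\to$ and with the unary operations ($\Delta$, $\tau_c$, $\upsilon_c$) present (no condition on atoms or modal formulas). A derivation system $\mathbf L$ consists of a set of logical rules $\langle\Gamma,\varphi\rangle$ (pairs of a set of formulas and a formula), all axioms and rules of $\mathbf{Ax}(\mathbb A)$, and for each $n$-ary $\lambda\in\Lambda$ the congruence rule: from $\pi_i\leftrightarrow\pi_i'$ ($i<n$) infer $\heartsuit_\lambda(\pi_0,\dots,\pi_{n-1})\leftrightarrow\heartsuit_\lambda(\pi_0',\dots,\pi_{n-1}')$; rules are used via substitution instances, and $\vdash_{\mathbf L}\varphi$ means there is a well-founded proof tree with root $\varphi$, leaves instances of axioms, and each inner node with its children an instance of a rule. -}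

module Defs where

open import Level using (0ℓ)
open import Data.Nat using (ℕ; zero; suc; _+_; _∸_; _⊔_; _⊓_; s≤s)
open import Data.Nat.Properties using (m⊓n≤n)
open import Data.Fin as Fin using (Fin; toℕ; fromℕ; fromℕ<)
open import Data.Bool using (Bool; true; false; if_then_else_)
open import Data.Sum using (_⊎_; inj₁; inj₂)
open import Data.Product using (_×_; _,_)
open import Data.Unit using (⊤; tt)
open import Data.Empty using (⊥)
open import Function using (_∘_; id)
open import Function.Bundles using (_↔_; _⇔_; Inverse)
open import Relation.Nullary using (¬_; Dec; yes; no; does)
open import Relation.Binary.PropositionalEquality using (_≡_; _≢_; refl; sym; trans; cong)
open import Relation.Binary.Definitions using (DecidableEquality)
open import Algebra.Core using (Op₂)
open import Algebra.Structures using (IsCommutativeMonoid)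
open import Algebra.Lattice.Structures using (IsLattice)

record FLew : Set₁ where
  field
    Carrier : Set
    _∨_ _∧_ _⊙_ _⇒_ : Op₂ Carrier
    𝟙 𝟘 : Carrier
    size : ℕ
    finite : Fin size ↔ Carrier
    isLattice : IsLattice _≡_ _∨_ _∧_
    isCommMonoid : IsCommutativeMonoid _≡_ _⊙_ 𝟙
    -- lattice order: x ≤ y iff x ∧ y ≡ x
    bottom : ∀ x → (𝟘 ∧ x) ≡ 𝟘
    integral : ∀ x → (x ∧ 𝟙) ≡ x
    residuation : ∀ x y z → (((x ⊙ y) ∧ z) ≡ (x ⊙ y)) ⇔ ((x ∧ (y ⇒ z)) ≡ x)

finDecEq : ∀ {n} {C : Set} → Fin n ↔ C → DecidableEquality C
finDecEq {C = C} inv x y with Inverse.from inv x Fin.≟ Inverse.from inv y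
... | yes p = yes (trans (sym (Inverse.strictlyInverseˡ inv x))
                   (trans (cong (Inverse.to inv) p) (Inverse.strictlyInverseˡ inv y)))
... | no ¬p = no (λ e → ¬p (cong (Inverse.from inv) e))

-- The algebra A together with the (non-modal) language L over it

record Setting : Set₁ where
  field
    Carrier : Set
    _∨_ _∧_ _⊙_ _⇒_ : Op₂ Carrier
    𝟙 𝟘 : Carrier
    Un : Set
    un : Un → Carrier → Carrier
    Con : Set
    con : Con → Carrier

-- the three admissible cases of the paper
data Instance : Set₁ where
  -- (i) the finite Łukasiewicz chain Ł_n = {0, 1/n, ..., 1} with n = suc k ≥ 1
  łuk : (k : ℕ) → Instance
  -- (ii) finite FL_ew-algebra with Baaz Delta and constants for all elements
  withΔ : FLew → Instance
  -- (iii) finite FL_ew-algebra with τ_c, υ_c for all c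
  withτυ : FLew → Instance

boolCon : {C : Set} → C → C → Bool → C
boolCon one nil true = one
boolCon one nil false = nil

module Łuk (n : ℕ) where
  -- element i ∈ Fin (suc n) stands for i/n
  clamp : ℕ → Fin (suc n)
  clamp m = fromℕ< (s≤s (m⊓n≤n m n))

  _∨ł_ _∧ł_ _⊙ł_ _⇒ł_ : Op₂ (Fin (suc n))
  x ∨ł y = clamp (toℕ x ⊔ toℕ y)
  x ∧ł y = clamp (toℕ x ⊓ toℕ y)
  x ⊙ł y = clamp ((toℕ x + toℕ y) ∸ n)
  x ⇒ł y = clamp ((n ∸ toℕ x) + toℕ y)

setting : Instance → Setting
setting (łuk k) = record
  { Carrier = Fin (suc n)
  ; _∨_ = _∨ł_ ; _∧_ = _∧ł_ ; _⊙_ = _⊙ł_ ; _⇒_ = _⇒ł_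
  ; 𝟙 = fromℕ n ; 𝟘 = Fin.zero
  ; Un = ⊥ ; un = λ ()
  ; Con = Bool ; con = boolCon (fromℕ n) Fin.zero
  }
  where
    n = suc k
    open Łuk n
setting (withΔ A) = record
  { Carrier = Carrier
  ; _∨_ = _∨_ ; _∧_ = _∧_ ; _⊙_ = _⊙_ ; _⇒_ = _⇒_
  ; 𝟙 = 𝟙 ; 𝟘 = 𝟘
  ; Un = ⊤ ; un = λ _ x → if does (x ≟ 𝟙) then 𝟙 else 𝟘
  ; Con = Bool ⊎ Carrier
  ; con = λ { (inj₁ b) → boolCon 𝟙 𝟘 b ; (inj₂ c) → c }
  }
  where
    open FLew A
    _≟_ = finDecEq finite
setting (withτυ A) = record
  { Carrier = Carrier
  ; _∨_ = _∨_ ; _∧_ = _∧_ ; _⊙_ = _⊙_ ; _⇒_ = _⇒_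
  ; 𝟙 = 𝟙 ; 𝟘 = 𝟘
  ; Un = Carrier ⊎ Carrier
  ; un = λ { (inj₁ c) x → if does (x ≟ c) then 𝟙 else 𝟘
           ; (inj₂ c) x → if does ((c ∧ x) ≟ c) then 𝟙 else 𝟘 }
  ; Con = Bool ; con = boolCon 𝟙 𝟘
  }
  where
    open FLew A
    _≟_ = finDecEq finite

module _ (S : Setting) where
  open Setting S
  _≤A_ _<A_ : Carrier → Carrier → Set
  a ≤A b = (a ∧ b) ≡ a
  a <A b = (a ≤A b) × (a ≢ b)

data Fm (S : Setting) (M : Set) (ar : M → ℕ) (P : Set) : Set where
  var : P → Fm S M ar P
  con : Setting.Con S → Fm S M ar P
  _∨̇_ _∧̇_ _⊙̇_ _⇒̇_ : Fm S M ar P → Fm S M ar P → Fm S M ar P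
  un : Setting.Un S → Fm S M ar P → Fm S M ar P
  ♡ : (l : M) → (Fin (ar l) → Fm S M ar P) → Fm S M ar P

_⇔̇_ : ∀ {S M ar P} → Fm S M ar P → Fm S M ar P → Fm S M ar P
φ ⇔̇ ψ = (φ ⇒̇ ψ) ⊙̇ (ψ ⇒̇ φ)

sub : ∀ {S M ar P Q} → (P → Fm S M ar Q) → Fm S M ar P → Fm S M ar Q
sub σ (var p) = σ p
sub σ (con c) = con c
sub σ (φ ∨̇ ψ) = sub σ φ ∨̇ sub σ ψ
sub σ (φ ∧̇ ψ) = sub σ φ ∧̇ sub σ ψ
sub σ (φ ⊙̇ ψ) = sub σ φ ⊙̇ sub σ ψ
sub σ (φ ⇒̇ ψ) = sub σ φ ⇒̇ sub σ ψ
sub σ (un u φ) = un u (sub σ φ)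
sub σ (♡ l f) = ♡ l (λ i → sub σ (f i))

-- the purely propositional language L over atoms P (no modalities)
noAr : ⊥ → ℕ
noAr ()

PFm : Setting → Set → Set
PFm S P = Fm S ⊥ noAr P

psub : ∀ {S M ar V P} → (V → Fm S M ar P) → PFm S V → Fm S M ar P
psub σ (var p) = σ p
psub σ (con c) = con c
psub σ (φ ∨̇ ψ) = psub σ φ ∨̇ psub σ ψ
psub σ (φ ∧̇ ψ) = psub σ φ ∧̇ psub σ ψ
psub σ (φ ⊙̇ ψ) = psub σ φ ⊙̇ psub σ ψ
psub σ (φ ⇒̇ ψ) = psub σ φ ⇒̇ psub σ ψ
psub σ (un u φ) = un u (psub σ φ)
psub σ (♡ () f)

⟦_⟧ : ∀ {S P} → PFm S P → (P → Setting.Carrier S) → Setting.Carrier S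
⟦_⟧ {S} (var p) e = e p
⟦_⟧ {S} (con c) e = Setting.con S c
⟦_⟧ {S} (φ ∨̇ ψ) e = Setting._∨_ S (⟦ φ ⟧ e) (⟦ ψ ⟧ e)
⟦_⟧ {S} (φ ∧̇ ψ) e = Setting._∧_ S (⟦ φ ⟧ e) (⟦ ψ ⟧ e)
⟦_⟧ {S} (φ ⊙̇ ψ) e = Setting._⊙_ S (⟦ φ ⟧ e) (⟦ ψ ⟧ e)
⟦_⟧ {S} (φ ⇒̇ ψ) e = Setting._⇒_ S (⟦ φ ⟧ e) (⟦ ψ ⟧ e)
⟦_⟧ {S} (un u φ) e = Setting.un S u (⟦ φ ⟧ e)
⟦_⟧ {S} (♡ () f) e

Conseq : ∀ {P} → (S : Setting) → (PFm S P → Set) → PFm S P → Set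
Conseq {P} S Γ φ = ∀ (e : P → Setting.Carrier S) →
  (∀ ψ → Γ ψ → ⟦ ψ ⟧ e ≡ Setting.𝟙 S) → ⟦ φ ⟧ e ≡ Setting.𝟙 S

record Axiomatization (S : Setting) : Set₁ where
  field
    R : Set
    prem : R → PFm S ℕ → Set
    concl : R → PFm S ℕ

data AxDeriv {S : Setting} (Ax : Axiomatization S) {P : Set}
             (Γ : PFm S P → Set) : PFm S P → Set where
  hyp : ∀ {φ} → Γ φ → AxDeriv Ax Γ φ
  rule : (r : Axiomatization.R Ax) (σ : ℕ → PFm S P) →
         (∀ ψ → Axiomatization.prem Ax r ψ → AxDeriv Ax Γ (psub σ ψ)) →
         AxDeriv Ax Γ (psub σ (Axiomatization.concl Ax r))

SoundComplete : (S : Setting) → Axiomatization S → Set₁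
SoundComplete S Ax = ∀ (P : Set) (Γ : PFm S P → Set) (φ : PFm S P) →
  (AxDeriv Ax Γ φ → Conseq S Γ φ) × (Conseq S Γ φ → AxDeriv Ax Γ φ)

record SetFunctor : Set₁ where
  field
    F : Set → Set
    fmap : ∀ {X Y : Set} → (X → Y) → F X → F Y
    fmap-id : ∀ {X : Set} (t : F X) → fmap id t ≡ t
    fmap-∘ : ∀ {X Y Z : Set} (f : X → Y) (g : Y → Z) (t : F X) →
             fmap (g ∘ f) t ≡ fmap g (fmap f t)

record Liftings (S : Setting) (T : SetFunctor) : Set₁ where
  open Setting S
  open SetFunctor T
  field
    Idx : Set
    ar : Idx → ℕ
    lift : (l : Idx) {X : Set} → (X → (Fin (ar l) → Carrier)) → F X → Carrier
    natural : (l : Idx) {X Y : Set} (f : X → Y) (g : Y → (Fin (ar l) → Carrier))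
              (t : F X) → lift l (g ∘ f) t ≡ lift l g (fmap f t)

ΛFm : (S : Setting) {T : SetFunctor} → Liftings S T → Set → Set
ΛFm S Λ P = Fm S (Liftings.Idx Λ) (Liftings.ar Λ) P

record LogicalRules (S : Setting) {T : SetFunctor} (Λ : Liftings S T) (P : Set) : Set₁ where
  field
    LR : Set
    lprem : LR → ΛFm S Λ P → Set
    lconcl : LR → ΛFm S Λ P

data Prov {S : Setting} {T : SetFunctor} {Λ : Liftings S T} {P : Set}
          (Ax : Axiomatization S) (Lg : LogicalRules S Λ P) : ΛFm S Λ P → Set where
  logical : (r : LogicalRules.LR Lg) (σ : P → ΛFm S Λ P) →
            (∀ ψ → LogicalRules.lprem Lg r ψ → Prov Ax Lg (sub σ ψ)) →
            Prov Ax Lg (sub σ (LogicalRules.lconcl Lg r))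
  axiomatic : (r : Axiomatization.R Ax) (σ : ℕ → ΛFm S Λ P) →
              (∀ ψ → Axiomatization.prem Ax r ψ → Prov Ax Lg (psub σ ψ)) →
              Prov Ax Lg (psub σ (Axiomatization.concl Ax r))
  congruence : (l : Liftings.Idx Λ) (π π′ : Fin (Liftings.ar Λ l) → ΛFm S Λ P) →
               (∀ i → Prov Ax Lg (π i ⇔̇ π′ i)) →
               Prov Ax Lg (♡ l π ⇔̇ ♡ l π′)

record IsNonModalHom (S : Setting) {M : Set} {ar : M → ℕ} {P : Set}
                     (h : Fm S M ar P → Setting.Carrier S) : Set where
  open Setting S hiding (con; un)
  field
    h-con : ∀ c → h (Fm.con c) ≡ Setting.con S c
    h-∨ : ∀ φ ψ → h (φ ∨̇ ψ) ≡ (h φ ∨ h ψ)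
    h-∧ : ∀ φ ψ → h (φ ∧̇ ψ) ≡ (h φ ∧ h ψ)
    h-⊙ : ∀ φ ψ → h (φ ⊙̇ ψ) ≡ (h φ ⊙ h ψ)
    h-⇒ : ∀ φ ψ → h (φ ⇒̇ ψ) ≡ (h φ ⇒ h ψ)
    h-un : ∀ u φ → h (Fm.un u φ) ≡ Setting.un S u (h φ)

InSbar : (S : Setting) {T : SetFunctor} {Λ : Liftings S T} {P : Set}
         (Ax : Axiomatization S) (Lg : LogicalRules S Λ P) →
         (ΛFm S Λ P → Setting.Carrier S) → Set
InSbar S Ax Lg s = IsNonModalHom S s × (∀ ψ → Prov Ax Lg ψ → s ψ ≡ Setting.𝟙 S)

-- Read every modal formula ♡_λ(…) (and every atom) as a fresh propositional atom: a formula χ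
-- of Λ(L) becomes a propositional formula skeleton χ over the atoms Λ(L), and χ is recovered
-- from it by substituting each atom by itself. Any Ax(A)-derivation from the skeletons of the
-- theorems of L therefore instantiates to an L-proof. So if φ is not a theorem, its skeleton
-- does not follow from the skeletons of the theorems, and by completeness of Ax(A) some
-- valuation e of these atoms makes every theorem true but not φ; evaluating skeletons under e
-- is the required non-modal homomorphism.
{-# OPTIONS --safe #-}
module Submission where

open import Defs
open import Level using (0ℓ)
open import Axiom.ExcludedMiddle using (ExcludedMiddle)
open import Axiom.DoubleNegationElimination using (em⇒dne)
open import Data.Product using (Σ; _×_; _,_; proj₂)
open import Data.Nat using (ℕ; suc; _⊓_)
open import Data.Fin using (toℕ; fromℕ)
open import Data.Fin.Properties using (toℕ-fromℕ; toℕ-fromℕ<; toℕ≤pred[n]; toℕ-injective)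
open import Data.Nat.Properties using (m≤n⇒m⊓n≡m)
open import Function using (id; _∘_)
open import Relation.Nullary using (¬_)
open import Relation.Binary.PropositionalEquality
  using (_≡_; _≢_; refl; cong; cong₂; subst; sym; module ≡-Reasoning)

module _ {S : Setting} {M : Set} {ar : M → ℕ} where

  skeleton : ∀ {P} → Fm S M ar P → PFm S (Fm S M ar P)
  skeleton (var p) = var (var p)
  skeleton (con c) = con c
  skeleton (φ ∨̇ ψ) = skeleton φ ∨̇ skeleton ψ
  skeleton (φ ∧̇ ψ) = skeleton φ ∧̇ skeleton ψ
  skeleton (φ ⊙̇ ψ) = skeleton φ ⊙̇ skeleton ψ
  skeleton (φ ⇒̇ ψ) = skeleton φ ⇒̇ skeleton ψ
  skeleton (un u φ) = un u (skeleton φ)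
  skeleton (♡ l π) = var (♡ l π)

  psub-id-skeleton : ∀ {P} (χ : Fm S M ar P) → psub id (skeleton χ) ≡ χ
  psub-id-skeleton (var p) = refl
  psub-id-skeleton (con c) = refl
  psub-id-skeleton (φ ∨̇ ψ) = cong₂ _∨̇_ (psub-id-skeleton φ) (psub-id-skeleton ψ)
  psub-id-skeleton (φ ∧̇ ψ) = cong₂ _∧̇_ (psub-id-skeleton φ) (psub-id-skeleton ψ)
  psub-id-skeleton (φ ⊙̇ ψ) = cong₂ _⊙̇_ (psub-id-skeleton φ) (psub-id-skeleton ψ)
  psub-id-skeleton (φ ⇒̇ ψ) = cong₂ _⇒̇_ (psub-id-skeleton φ) (psub-id-skeleton ψ)
  psub-id-skeleton (un u φ) = cong (un u) (psub-id-skeleton φ)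
  psub-id-skeleton (♡ l π) = refl

  psub-psub : ∀ {V W P} (τ : W → Fm S M ar P) (σ : V → PFm S W) (ψ : PFm S V) →
              psub τ (psub σ ψ) ≡ psub (psub τ ∘ σ) ψ
  psub-psub τ σ (var v) = refl
  psub-psub τ σ (con c) = refl
  psub-psub τ σ (φ ∨̇ ψ) = cong₂ _∨̇_ (psub-psub τ σ φ) (psub-psub τ σ ψ)
  psub-psub τ σ (φ ∧̇ ψ) = cong₂ _∧̇_ (psub-psub τ σ φ) (psub-psub τ σ ψ)
  psub-psub τ σ (φ ⊙̇ ψ) = cong₂ _⊙̇_ (psub-psub τ σ φ) (psub-psub τ σ ψ)
  psub-psub τ σ (φ ⇒̇ ψ) = cong₂ _⇒̇_ (psub-psub τ σ φ) (psub-psub τ σ ψ)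
  psub-psub τ σ (un u φ) = cong (un u) (psub-psub τ σ φ)
  psub-psub τ σ (♡ () π)

  ⟦skeleton⟧-isNonModalHom : ∀ {P} (e : Fm S M ar P → Setting.Carrier S) →
                             IsNonModalHom S (λ χ → ⟦ skeleton χ ⟧ e)
  ⟦skeleton⟧-isNonModalHom e = record
    { h-con = λ _ → refl ; h-∨ = λ _ _ → refl ; h-∧ = λ _ _ → refl
    ; h-⊙ = λ _ _ → refl ; h-⇒ = λ _ _ → refl ; h-un = λ _ _ → refl }

module _ {S : Setting} {T : SetFunctor} {Λ : Liftings S T} {P : Set}
         (Ax : Axiomatization S) (Lg : LogicalRules S Λ P) where

  instantiate-AxDeriv : ∀ {W} {Γ : PFm S W → Set} (τ : W → ΛFm S Λ P) →
                        (∀ {χ} → Γ χ → Prov Ax Lg (psub τ χ)) →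
                        ∀ {χ} → AxDeriv Ax Γ χ → Prov Ax Lg (psub τ χ)
  instantiate-AxDeriv τ prov-Γ (hyp γ) = prov-Γ γ
  instantiate-AxDeriv τ prov-Γ (rule r σ ds) =
    subst (Prov Ax Lg) (sym (psub-psub τ σ (Axiomatization.concl Ax r)))
      (axiomatic r (psub τ ∘ σ) λ ψ pr →
        subst (Prov Ax Lg) (psub-psub τ σ ψ) (instantiate-AxDeriv τ prov-Γ (ds ψ pr)))

  SkeletonOfTheorem : PFm S (ΛFm S Λ P) → Set
  SkeletonOfTheorem χ = Σ (ΛFm S Λ P) λ ψ → Prov Ax Lg ψ × skeleton ψ ≡ χ

  prov-SkeletonOfTheorem : ∀ {χ} → SkeletonOfTheorem χ → Prov Ax Lg (psub id χ)
  prov-SkeletonOfTheorem (ψ , ⊢ψ , refl) =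
    subst (Prov Ax Lg) (sym (psub-id-skeleton ψ)) ⊢ψ

  skeleton-reflects-AxDeriv : ∀ {φ} → AxDeriv Ax SkeletonOfTheorem (skeleton φ) → Prov Ax Lg φ
  skeleton-reflects-AxDeriv {φ} d =
    subst (Prov Ax Lg) (psub-id-skeleton φ) (instantiate-AxDeriv id prov-SkeletonOfTheorem d)

module _ (S : Setting) where
  open Setting S using (Carrier; 𝟙)

  Countermodel : ∀ {P} → (PFm S P → Set) → PFm S P → Set
  Countermodel {P} Γ φ =
    Σ (P → Carrier) λ e → (∀ ψ → Γ ψ → ⟦ ψ ⟧ e ≡ 𝟙) × ⟦ φ ⟧ e ≢ 𝟙

  ¬Conseq⇒Countermodel : ExcludedMiddle 0ℓ → ∀ {P} {Γ : PFm S P → Set} {φ : PFm S P} →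
                         ¬ Conseq S Γ φ → Countermodel Γ φ
  ¬Conseq⇒Countermodel em ⊭φ =
    dne λ ¬countermodel → ⊭φ λ e ⊨Γ → dne λ ⊭ → ¬countermodel (e , ⊨Γ , ⊭)
    where dne = em⇒dne em

x≤A𝟙 : ∀ ι (x : Setting.Carrier (setting ι)) → _≤A_ (setting ι) x (Setting.𝟙 (setting ι))
x≤A𝟙 (łuk k) x = toℕ-injective (begin
    toℕ (Łuk.clamp n (toℕ x ⊓ toℕ (fromℕ n))) ≡⟨ toℕ-fromℕ< _ ⟩
    (toℕ x ⊓ toℕ (fromℕ n)) ⊓ n               ≡⟨ cong (λ m → (toℕ x ⊓ m) ⊓ n) (toℕ-fromℕ n) ⟩
    (toℕ x ⊓ n) ⊓ n                           ≡⟨ cong (_⊓ n) x⊓n≡x ⟩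
    toℕ x ⊓ n                                 ≡⟨ x⊓n≡x ⟩
    toℕ x                                     ∎)
  where
    n = suc k
    x⊓n≡x = m≤n⇒m⊓n≡m (toℕ≤pred[n] x)
    open ≡-Reasoning
x≤A𝟙 (withΔ A) = FLew.integral A
x≤A𝟙 (withτυ A) = FLew.integral A

mainTheorem4 : ExcludedMiddle 0ℓ →
    (ι : Instance) → (Ax : Axiomatization (setting ι)) → SoundComplete (setting ι) Ax →
    (T : SetFunctor) (Λ : Liftings (setting ι) T) (P : Set)
    (Lg : LogicalRules (setting ι) Λ P) (φ : ΛFm (setting ι) Λ P) →
    ¬ Prov Ax Lg φ →
    Σ (ΛFm (setting ι) Λ P → Setting.Carrier (setting ι)) (λ s →
      InSbar (setting ι) Ax Lg s × _<A_ (setting ι) (s φ) (Setting.𝟙 (setting ι)))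
mainTheorem4 em ι Ax sound-complete _ Λ P Lg φ ⊬φ =
  let e , e⊨Γ , e⊭φ = countermodel
      s = λ χ → ⟦ skeleton χ ⟧ e
  in  s , (⟦skeleton⟧-isNonModalHom e , λ ψ ⊢ψ → e⊨Γ (skeleton ψ) (ψ , ⊢ψ , refl))
        , (x≤A𝟙 ι (s φ) , e⊭φ)
  where
    Γ : PFm (setting ι) (ΛFm (setting ι) Λ P) → Set
    Γ = SkeletonOfTheorem Ax Lg
    ⊭φ : ¬ Conseq (setting ι) Γ (skeleton φ)
    ⊭φ ⊨φ = ⊬φ (skeleton-reflects-AxDeriv Ax Lg (proj₂ (sound-complete _ Γ (skeleton φ)) ⊨φ))
    countermodel : Countermodel (setting ι) Γ (skeleton φ)
    countermodel = ¬Conseq⇒Countermodel (setting ι) em {φ = skeleton φ} ⊭φ
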